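{- Let $Q$ be a uniformly sign-coherent ice quiver whose mutable subquiver is abundant and acyclic, with unique acyclic ordering $v_1\prec\dots\prec v_n$. Pick a vertex $v_j$ and let $Q'=\mu_{v_j}(Q)$. (i) If $v_j$ is blue in $Q$, then the color of every mutable vertex is unchanged after mutation. (ii) If $v_j$ is green in $Q$, then the color of every vertex $v_i$ with $v_j\prec v_i$ is unchanged, and $v_j$ is red in $Q'$. (iii) If $v_j$ is red in $Q$, then the color of every vertex $v_i$ with $v_i\prec v_j$ is unchanged, and $v_j$ is green in $Q'$.
   Context: Quivers have no loops or 2-cycles. An ice quiver has vertices partitioned into mutable and frozen; its mutable subquiver is the full subquiver on mutable vertices. Mutation at a mutable vertex $k$: add an arrow $a\to b$ for each path $a\to k\to b$, reverse all arrows at $k$, remove 2-cycles. A mutable vertex $i$ is green if it has at least one arrow to/from a frozen vertex and all such arrows go from $i$ to frozen vertices; red if it has at least one such arrow and all go from frozen vertices to $i$; blue if it has no arrows to or from frozen vertices. An ice quiver is uniformly sign-coherent if every ice quiver obtained from it by mutation sequences has every mutable vertex red, green or blue, and moreover not every mutable vertex of it is blue. Abundant: at least two arrows between every pair of distinct vertices; acyclic: no directed cycle. An acyclic ordering is a total order $\prec$ with $v_i\prec v_j$ whenever there is an arrow $v_i\to v_j$. -}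

module Defs where

open import Data.Nat using (ℕ; zero; suc; _+_; _*_; _∸_; _<_; _≥_)
open import Data.Fin using (Fin)
import Data.Fin.Properties as FinP
open import Data.Sum using (_⊎_; inj₁; inj₂)
open import Data.Sum.Properties using (≡-dec)
open import Data.Product using (_×_; ∃-syntax)
open import Data.List using (List; []; _∷_)
open import Relation.Nullary using (¬_; yes; no)
open import Relation.Binary.PropositionalEquality using (_≡_)
open import Relation.Binary.Construct.Closure.Transitive using (TransClosure)
open import Function.Definitions using (Injective)

-- Vertices of an ice quiver with n mutable and m frozen vertices:
-- inj₁ i is the mutable vertex i, inj₂ f is the frozen vertex f.
Vtx : ℕ → ℕ → Set
Vtx n m = Fin n ⊎ Fin m

-- A quiver is given by its arrow multiplicities: Q x y = number of arrows x → y.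
Quiver : ℕ → ℕ → Set
Quiver n m = Vtx n m → Vtx n m → ℕ

WellFormed : ∀ {n m} → Quiver n m → Set
WellFormed {n} {m} Q =
  ((x : Vtx n m) → Q x x ≡ 0) × ((x y : Vtx n m) → (Q x y ≡ 0) ⊎ (Q y x ≡ 0))

_≟V_ : ∀ {n m} (x y : Vtx n m) → Relation.Nullary.Dec (x ≡ y)
_≟V_ = ≡-dec FinP._≟_ FinP._≟_

-- Mutation at the mutable vertex k: add an arrow a → b for each path a → k → b,
-- reverse all arrows at k, then remove 2-cycles (cancel opposite arrows).
mutate : ∀ {n m} → Fin n → Quiver n m → Quiver n m
mutate k Q x y with x ≟V inj₁ k | y ≟V inj₁ k
... | yes _ | _     = Q y x
... | no _  | yes _ = Q y x
... | no _  | no _  =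
  (Q x y + Q x (inj₁ k) * Q (inj₁ k) y) ∸ (Q y x + Q y (inj₁ k) * Q (inj₁ k) x)

mutateSeq : ∀ {n m} → List (Fin n) → Quiver n m → Quiver n m
mutateSeq []       Q = Q
mutateSeq (k ∷ ks) Q = mutateSeq ks (mutate k Q)

Green : ∀ {n m} → Quiver n m → Fin n → Set
Green {n} {m} Q i =
  (∃[ f ] (Q (inj₁ i) (inj₂ f) ≥ 1)) × ((f : Fin m) → Q (inj₂ f) (inj₁ i) ≡ 0)

Red : ∀ {n m} → Quiver n m → Fin n → Set
Red {n} {m} Q i =
  (∃[ f ] (Q (inj₂ f) (inj₁ i) ≥ 1)) × ((f : Fin m) → Q (inj₁ i) (inj₂ f) ≡ 0)

Blue : ∀ {n m} → Quiver n m → Fin n → Set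
Blue {n} {m} Q i =
  (f : Fin m) → (Q (inj₁ i) (inj₂ f) ≡ 0) × (Q (inj₂ f) (inj₁ i) ≡ 0)

data Colour : Set where
  red green blue : Colour

HasColour : ∀ {n m} → Quiver n m → Fin n → Colour → Set
HasColour Q i red   = Red Q i
HasColour Q i green = Green Q i
HasColour Q i blue  = Blue Q i

ColourUnchanged : ∀ {n m} → Quiver n m → Quiver n m → Fin n → Set
ColourUnchanged Q Q' i = (c : Colour) → HasColour Q i c → HasColour Q' i c

UniformlySignCoherent : ∀ {n m} → Quiver n m → Set
UniformlySignCoherent {n} Q =
  ((ks : List (Fin n)) (i : Fin n) →
     Red (mutateSeq ks Q) i ⊎ Green (mutateSeq ks Q) i ⊎ Blue (mutateSeq ks Q) i)
  × ¬ ((i : Fin n) → Blue Q i)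

MArrow : ∀ {n m} → Quiver n m → Fin n → Fin n → Set
MArrow Q i j = Q (inj₁ i) (inj₁ j) ≥ 1

Abundant : ∀ {n m} → Quiver n m → Set
Abundant {n} Q = (i j : Fin n) → ¬ (i ≡ j) →
  Q (inj₁ i) (inj₁ j) + Q (inj₁ j) (inj₁ i) ≥ 2

Acyclic : ∀ {n m} → Quiver n m → Set
Acyclic {n} Q = (i : Fin n) → ¬ TransClosure (MArrow Q) i i

-- An acyclic ordering of the mutable vertices, given by an injective position
-- function (v_i ≺ v_j iff pos i < pos j) compatible with all arrows.
AcyclicOrdering : ∀ {n m} → Quiver n m → (Fin n → ℕ) → Set
AcyclicOrdering {n} Q pos =
  Injective _≡_ _≡_ pos × ((i j : Fin n) → MArrow Q i j → pos i < pos j)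

-- Mutation at k changes an arrow between vertices x, y ≠ k only through the paths
-- x → k → y and y → k → x, and it reverses the arrows at k.  For a blue k no
-- frozen vertex is adjacent to k, so no such path joins a mutable i to a frozen f.
-- For a green k there is no arrow f → k, and for k ≺ i no arrow i → k; for a red k
-- symmetrically.  So the frozen arrows at those i, hence their colours, survive,
-- while reversing the arrows at k swaps green and red.
module Submission where

open import Defs
open import Data.Nat using (ℕ; _<_; _≥_; _+_; _*_; _∸_)
open import Data.Nat.Properties using (+-identityʳ; *-zeroʳ; 0∸n≡0; <-asym; <-irrefl; ≮⇒≥; n≤0⇒n≡0)
open import Data.Fin using (Fin; _≟_)
open import Function using (_∘_)
open import Data.Product using (_×_; _,_; proj₁; proj₂)
open import Data.Sum using (_⊎_; inj₁; inj₂; swap)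
open import Data.Sum.Properties using (inj₁-injective)
open import Data.Empty using (⊥-elim)
open import Relation.Nullary using (¬_; Dec; yes; no)
open import Relation.Binary.PropositionalEquality

m≡0⇒m*n≡0 : ∀ {m} n → m ≡ 0 → m * n ≡ 0
m≡0⇒m*n≡0 n refl = refl

n≡0⇒m*n≡0 : ∀ m {n} → n ≡ 0 → m * n ≡ 0
n≡0⇒m*n≡0 m refl = *-zeroʳ m

m≡0∨n≡0⇒m∸n≡m : ∀ {m n} → m ≡ 0 ⊎ n ≡ 0 → m ∸ n ≡ m
m≡0∨n≡0⇒m∸n≡m {n = n} (inj₁ refl) = 0∸n≡0 n
m≡0∨n≡0⇒m∸n≡m         (inj₂ refl) = refl

module _ {n m : ℕ} (Q : Quiver n m) (k : Fin n) where

  mutate-elsewhere : ∀ {x y} → ¬ x ≡ inj₁ k → ¬ y ≡ inj₁ k →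
    mutate k Q x y ≡
      (Q x y + Q x (inj₁ k) * Q (inj₁ k) y) ∸ (Q y x + Q y (inj₁ k) * Q (inj₁ k) x)
  mutate-elsewhere {x} {y} x≢k y≢k with x ≟V inj₁ k | y ≟V inj₁ k
  ... | yes x≡k | _       = ⊥-elim (x≢k x≡k)
  ... | no _    | yes y≡k = ⊥-elim (y≢k y≡k)
  ... | no _    | no _    = refl

  mutate-from-vertex : ∀ y → mutate k Q (inj₁ k) y ≡ Q y (inj₁ k)
  mutate-from-vertex y with inj₁ {B = Fin m} k ≟V inj₁ k
  ... | yes _   = refl
  ... | no k≢k  = ⊥-elim (k≢k refl)

  mutate-to-vertex : ∀ x → mutate k Q x (inj₁ k) ≡ Q (inj₁ k) x
  mutate-to-vertex x with x ≟V inj₁ k | inj₁ {B = Fin m} k ≟V inj₁ k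
  ... | yes refl | _       = refl
  ... | no _     | yes _   = refl
  ... | no _     | no k≢k  = ⊥-elim (k≢k refl)

  NoPathVia : Vtx n m → Vtx n m → Set
  NoPathVia x y = Q x (inj₁ k) * Q (inj₁ k) y ≡ 0

  mutate-stable : ∀ {x y} → ¬ x ≡ inj₁ k → ¬ y ≡ inj₁ k →
    Q x y ≡ 0 ⊎ Q y x ≡ 0 → NoPathVia x y → NoPathVia y x →
    mutate k Q x y ≡ Q x y
  mutate-stable {x} {y} x≢k y≢k no2cycle x→k→y y→k→x = begin
    mutate k Q x y
      ≡⟨ mutate-elsewhere x≢k y≢k ⟩
    (Q x y + Q x (inj₁ k) * Q (inj₁ k) y) ∸ (Q y x + Q y (inj₁ k) * Q (inj₁ k) x)
      ≡⟨ cong₂ _∸_ (cong (Q x y +_) x→k→y) (cong (Q y x +_) y→k→x) ⟩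
    (Q x y + 0) ∸ (Q y x + 0)
      ≡⟨ cong₂ _∸_ (+-identityʳ (Q x y)) (+-identityʳ (Q y x)) ⟩
    Q x y ∸ Q y x
      ≡⟨ m≡0∨n≡0⇒m∸n≡m no2cycle ⟩
    Q x y ∎
    where open ≡-Reasoning

FrozenArrowsAgree : ∀ {n m} → Quiver n m → Quiver n m → Fin n → Set
FrozenArrowsAgree {m = m} Q Q' i =
  ((f : Fin m) → Q' (inj₁ i) (inj₂ f) ≡ Q (inj₁ i) (inj₂ f)) ×
  ((f : Fin m) → Q' (inj₂ f) (inj₁ i) ≡ Q (inj₂ f) (inj₁ i))

frozenArrowsAgree⇒colourUnchanged : ∀ {n m} {Q Q' : Quiver n m} {i} →
  FrozenArrowsAgree Q Q' i → ColourUnchanged Q Q' i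
frozenArrowsAgree⇒colourUnchanged (out , in′) red ((f , f→i) , no-i→) =
  (f , subst (_≥ 1) (sym (in′ f)) f→i) , λ g → trans (out g) (no-i→ g)
frozenArrowsAgree⇒colourUnchanged (out , in′) green ((f , i→f) , no-→i) =
  (f , subst (_≥ 1) (sym (out f)) i→f) , λ g → trans (in′ g) (no-→i g)
frozenArrowsAgree⇒colourUnchanged (out , in′) blue none f =
  trans (out f) (proj₁ (none f)) , trans (in′ f) (proj₂ (none f))

module _ {n m : ℕ} (Q : Quiver n m) (k : Fin n) where

  green⇒red-after-mutation : Green Q k → Red (mutate k Q) k
  green⇒red-after-mutation ((f , k→f) , no-→k) =
      (f , subst (_≥ 1) (sym (mutate-to-vertex Q k (inj₂ f))) k→f)
    , λ g → trans (mutate-from-vertex Q k (inj₂ g)) (no-→k g)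

  red⇒green-after-mutation : Red Q k → Green (mutate k Q) k
  red⇒green-after-mutation ((f , f→k) , no-k→) =
      (f , subst (_≥ 1) (sym (mutate-from-vertex Q k (inj₂ f))) f→k)
    , λ g → trans (mutate-to-vertex Q k (inj₂ g)) (no-k→ g)

  blue⇒frozenArrowsAgree-after-mutation : Blue Q k → FrozenArrowsAgree Q (mutate k Q) k
  blue⇒frozenArrowsAgree-after-mutation none =
      (λ f → trans (mutate-from-vertex Q k (inj₂ f)) (trans (proj₂ (none f)) (sym (proj₁ (none f)))))
    , (λ f → trans (mutate-to-vertex Q k (inj₂ f)) (trans (proj₁ (none f)) (sym (proj₂ (none f)))))

no-arrow-against-order : ∀ {n m} (Q : Quiver n m) {pos} → AcyclicOrdering Q pos →
  ∀ {i j} → pos j < pos i → Q (inj₁ i) (inj₁ j) ≡ 0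
no-arrow-against-order Q (_ , compatible) {i} {j} j<i =
  n≤0⇒n≡0 (≮⇒≥ (λ i→j → <-asym j<i (compatible i j i→j)))

module _ {n m : ℕ} (Q : Quiver n m) (wf : WellFormed Q) (k : Fin n) where

  mutate-preserves-frozenArrows : ∀ {i} → ¬ i ≡ k →
    ((f : Fin m) → NoPathVia Q k (inj₁ i) (inj₂ f)) →
    ((f : Fin m) → NoPathVia Q k (inj₂ f) (inj₁ i)) →
    FrozenArrowsAgree Q (mutate k Q) i
  mutate-preserves-frozenArrows {i} i≢k i→k→f f→k→i =
      (λ f → mutate-stable Q k i≢k′ (λ ()) (no2cycle f) (i→k→f f) (f→k→i f))
    , (λ f → mutate-stable Q k (λ ()) i≢k′ (swap (no2cycle f)) (f→k→i f) (i→k→f f))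
    where
    i≢k′ : ¬ inj₁ i ≡ inj₁ k
    i≢k′ = i≢k ∘ inj₁-injective
    no2cycle : ∀ f → Q (inj₁ i) (inj₂ f) ≡ 0 ⊎ Q (inj₂ f) (inj₁ i) ≡ 0
    no2cycle f = proj₂ wf (inj₁ i) (inj₂ f)

  blue-mutation-preserves-colours : Blue Q k → ∀ i → ColourUnchanged Q (mutate k Q) i
  blue-mutation-preserves-colours none i = frozenArrowsAgree⇒colourUnchanged (agree (i ≟ k))
    where
    agree : Dec (i ≡ k) → FrozenArrowsAgree Q (mutate k Q) i
    agree (yes refl) = blue⇒frozenArrowsAgree-after-mutation Q k none
    agree (no i≢k)   = mutate-preserves-frozenArrows i≢k
      (λ f → n≡0⇒m*n≡0 (Q (inj₁ i) (inj₁ k)) (proj₁ (none f)))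
      (λ f → m≡0⇒m*n≡0 (Q (inj₁ k) (inj₁ i)) (proj₂ (none f)))

  module _ {pos : Fin n → ℕ} (ordering : AcyclicOrdering Q pos) where

    green-mutation-preserves-later-colours : Green Q k →
      ∀ i → pos k < pos i → ColourUnchanged Q (mutate k Q) i
    green-mutation-preserves-later-colours (_ , no-→k) i k<i =
      frozenArrowsAgree⇒colourUnchanged (mutate-preserves-frozenArrows
        (λ { refl → <-irrefl refl k<i })
        (λ f → m≡0⇒m*n≡0 (Q (inj₁ k) (inj₂ f)) (no-arrow-against-order Q ordering k<i))
        (λ f → m≡0⇒m*n≡0 (Q (inj₁ k) (inj₁ i)) (no-→k f)))

    red-mutation-preserves-earlier-colours : Red Q k →
      ∀ i → pos i < pos k → ColourUnchanged Q (mutate k Q) i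
    red-mutation-preserves-earlier-colours (_ , no-k→) i i<k =
      frozenArrowsAgree⇒colourUnchanged (mutate-preserves-frozenArrows
        (λ { refl → <-irrefl refl i<k })
        (λ f → n≡0⇒m*n≡0 (Q (inj₁ i) (inj₁ k)) (no-k→ f))
        (λ f → n≡0⇒m*n≡0 (Q (inj₂ f) (inj₁ k)) (no-arrow-against-order Q ordering i<k)))

lemma4p2 : {n m : ℕ} (Q : Quiver n m) → WellFormed Q →
    UniformlySignCoherent Q → Abundant Q → Acyclic Q →
    (pos : Fin n → ℕ) → AcyclicOrdering Q pos → (j : Fin n) →
    (Blue Q j → (i : Fin n) → ColourUnchanged Q (mutate j Q) i)
    × (Green Q j → ((i : Fin n) → pos j < pos i → ColourUnchanged Q (mutate j Q) i)
                   × Red (mutate j Q) j)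
    × (Red Q j → ((i : Fin n) → pos i < pos j → ColourUnchanged Q (mutate j Q) i)
                 × Green (mutate j Q) j)
lemma4p2 Q wf _ _ _ pos ordering j =
    blue-mutation-preserves-colours Q wf j
  , (λ j-green → green-mutation-preserves-later-colours Q wf j ordering j-green
               , green⇒red-after-mutation Q j j-green)
  , (λ j-red → red-mutation-preserves-earlier-colours Q wf j ordering j-red
             , red⇒green-after-mutation Q j j-red)
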